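{- Let $a,t,s$ be integers with $t\ge a+1\ge 3$ and $s\ge 2$. Then \[ R^{a+1}\big(SK^{(a)}_t, TK_s\big)\le t+\max\big\{R^{a+1}\big(SK^{(a)}_{t-1},TK_s\big),\ R^{a+1}\big(SK^{(a)}_t,TK_{s-1}\big)\big\}. \]
   Context: $K^{(a)}_n$ is the complete $a$-uniform hypergraph on $n$ vertices and $K_n$ the complete graph. For an $a$-uniform hypergraph $\mathcal{H}$, its $(a+1)$-suspension $S\mathcal{H}$ is obtained by adding one fixed new vertex $u$ to every hyperedge: $V(S\mathcal{H})=V(\mathcal{H})\cup\{u\}$, $E(S\mathcal{H})=\{e\cup\{u\}:e\in E(\mathcal{H})\}$. For a hypergraph $\mathcal{H}'$ and $S\subseteq V(\mathcal{H}')$, $\mathrm{Tr}(\mathcal{H}',S)$ is the hypergraph on $S$ with hyperedges $\{h\cap S:h\in E(\mathcal{H}')\}$; for a graph $G$, $TG$ is the set of $(a+1)$-uniform hypergraphs $\mathcal{H}'$ with $V(G)\subseteq V(\mathcal{H}')$ and $\mathrm{Tr}(\mathcal{H}',V(G))=G$. For collections $\mathcal{F}_1,\mathcal{F}_2$ of $r$-uniform hypergraphs (a single hypergraph being a one-element collection), $R^r(\mathcal{F}_1,\mathcal{F}_2)$ is the least $N$ such that every 2-coloring of the hyperedges of the complete $r$-uniform hypergraph on $N$ vertices contains a subhypergraph of the first color isomorphic to a member of $\mathcal{F}_1$ or one of the second color isomorphic to a member of $\mathcal{F}_2$. Here $r=a+1$. -}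

module Defs where

open import Level using (0ℓ; Lift)
open import Data.Nat using (ℕ; suc; _≤_)
open import Data.Bool using (Bool; true; false)
open import Data.Fin using (Fin; _≟_)
open import Data.Fin.Subset using (Subset; inside; outside; ∣_∣; _∈_)
open import Data.Fin.Subset.Properties using (_∈?_)
open import Data.Fin.Properties using (any?)
open import Data.Vec using (_∷_; tabulate; lookup)
open import Data.Product using (Σ; ∃; _×_; _,_)
open import Data.Sum using (_⊎_)
open import Function.Definitions using (Injective)
open import Relation.Nullary using (does)
open import Relation.Nullary.Decidable using (_×-dec_)
open import Relation.Binary.PropositionalEquality using (_≡_)

record Hypergraph : Set₁ where
  field
    vsize : ℕ
    Edge  : Subset vsize → Set
open Hypergraph public

Uniform : ℕ → Hypergraph → Set
Uniform r H = ∀ e → Edge H e → ∣ e ∣ ≡ r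

Family : Set₂
Family = Hypergraph → Set₁

single : Hypergraph → Family
single H G = G ≡ H

image : ∀ {n N} → (Fin n → Fin N) → Subset n → Subset N
image f e = tabulate λ j → does (any? λ i → (i ∈? e) ×-dec (f i ≟ j))

preimage : ∀ {n N} → (Fin n → Fin N) → Subset N → Subset n
preimage f h = tabulate λ i → lookup h (f i)

-- A 2-colouring of the hyperedges of the complete r-uniform hypergraph on Fin N:
-- a map Subset N → Bool (only its values on r-subsets matter). Colour true = first colour.
Colouring : ℕ → Set
Colouring N = Subset N → Bool

ContainsCopy : ∀ {N} → ℕ → Colouring N → Bool → Hypergraph → Set
ContainsCopy {N} r c b H =
  Σ (Fin (vsize H) → Fin N) λ f → Injective _≡_ _≡_ f ×
    (∀ e → Edge H e → (∣ image f e ∣ ≡ r) × (c (image f e) ≡ b))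

ContainsFam : ∀ {N} → ℕ → Colouring N → Bool → Family → Set₁
ContainsFam r c b F = Σ Hypergraph λ H → F H × ContainsCopy r c b H

RamseyProperty : ℕ → Family → Family → ℕ → Set₁
RamseyProperty r F₁ F₂ N =
  (c : Colouring N) → ContainsFam r c true F₁ ⊎ ContainsFam r c false F₂

IsRamseyNumber : ℕ → Family → Family → ℕ → Set₁
IsRamseyNumber r F₁ F₂ R =
  RamseyProperty r F₁ F₂ R × (∀ N → RamseyProperty r F₁ F₂ N → R ≤ N)

-- The (a+1)-suspension S K^{(a)}_t: vertices Fin (suc t), with new vertex u = zero;
-- hyperedges are {u} ∪ e for e an a-subset of the original t vertices.
SK : ℕ → ℕ → Hypergraph
SK a t = record
  { vsize = suc t
  ; Edge  = λ e → Σ (Subset t) λ e′ → (∣ e′ ∣ ≡ a) × (e ≡ inside ∷ e′) }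

-- T K_s (with a+1 uniformity): (a+1)-uniform hypergraphs H' with V(K_s) ⊆ V(H')
-- (via an injection ι) and Tr(H', V(K_s)) = K_s, i.e. every trace h ∩ V(K_s) is an
-- edge (2-subset) of K_s and every edge of K_s arises as a trace.
TK : ℕ → ℕ → Family
TK a s H = Lift _ (
  Σ (Fin s → Fin (vsize H)) λ ι → Injective _≡_ _≡_ ι ×
    Uniform (suc a) H ×
    (∀ h → Edge H h → ∣ preimage ι h ∣ ≡ 2) ×
    (∀ (p : Subset s) → ∣ p ∣ ≡ 2 → Σ (Subset (vsize H)) λ h → Edge H h × (preimage ι h ≡ p)))

-- Colour K^(a+1)_N, N = t + max(R₁, R₂), with colour true as first colour. On R₁ of the
-- vertices there is a second-colour TK_s or a first-colour S K_{t-1} with apex u; pick R₂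
-- vertices outside that copy. If for one of them, x, every edge formed by u, x and a - 1 base
-- vertices of the copy has the first colour, x extends the copy to an S K_t. Otherwise every
-- such x has a second-colour "fan" edge B_x through u and x. On the R₂ vertices we find an
-- S K_t of the first colour, or a TK_{s-1} of the second colour; in the latter case u becomes
-- a new vertex of K_s and the fan edges of the core vertices supply its traces {u, x}.
module Submission where

open import Defs
open import Level using (lift)
open import Data.Nat using (ℕ; zero; suc; _+_; _∸_; _≤_; _⊔_; s≤s)
import Data.Nat.Properties as ℕ
open import Data.Bool using (Bool; true; false)
import Data.Bool.Properties as Bool
open import Data.Fin using (Fin; zero; suc; inject≤)
open import Data.Fin.Properties using (any?; all?; ¬∀⟶∃¬; suc-injective; inject≤-injective)
open import Data.Fin.Subset using (Subset; inside; outside; ∣_∣; _∈_; _∉_; _⊆_; ⊤; ⊥; ∁; ⁅_⁆; _∪_)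
open import Data.Fin.Subset.Properties
  using (⊆-antisym; ∉⊥; ∈⊤; x∈⁅x⁆; x∈⁅y⁆⇒x≡y; ∣⊥∣≡0; ∣⁅x⁆∣≡1; ∣⊤∣≡n; ∣∁p∣≡n∸∣p∣;
         x∈p∪q⁺; x∈p∪q⁻; ∪-identityˡ; x∈∁p⇒x∉p; anySubset?)
open import Data.Vec using ([]; _∷_; lookup; here; there)
open import Data.Vec.Properties using (lookup∘tabulate; []=⇒lookup; lookup⇒[]=)
import Data.Vec.Functional as Vector
open import Data.Product using (Σ; ∃; _×_; _,_; proj₁; proj₂)
open import Data.Sum using (_⊎_; inj₁; inj₂)
import Data.Sum as Sum
open import Data.Empty using (⊥-elim)
open import Function using (_∘_; id; case_of_)
open import Function.Definitions using (Injective)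
open import Relation.Nullary using (Dec; proof; yes; no; ¬_; Reflects; invert)
open import Relation.Nullary.Decidable using (_×-dec_; dec-true)
open import Relation.Binary.PropositionalEquality
  using (_≡_; _≢_; refl; sym; trans; cong; cong₂; subst; module ≡-Reasoning)

private
  variable
    n m N : ℕ

∈-image⁺ : (f : Fin n → Fin N) {e : Subset n} {i : Fin n} → i ∈ e → f i ∈ image f e
∈-image⁺ f {e} {i} i∈e = lookup⇒[]= (f i) (image f e)
  (trans (lookup∘tabulate _ (f i)) (dec-true (any? _) (i , i∈e , refl)))

∈-image⁻ : (f : Fin n → Fin N) (e : Subset n) {j : Fin N} → j ∈ image f e → ∃ λ i → i ∈ e × f i ≡ j
∈-image⁻ f e {j} j∈ =
  invert (subst (Reflects _) (trans (sym (lookup∘tabulate _ j)) ([]=⇒lookup j∈)) (proof (any? _)))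

∈-image-injective⁻ : {f : Fin n → Fin N} {e : Subset n} {i : Fin n} →
  Injective _≡_ _≡_ f → f i ∈ image f e → i ∈ e
∈-image-injective⁻ {f = f} {e} f-inj fi∈ with ∈-image⁻ f e fi∈
... | k , k∈e , fk≡fi = subst (_∈ e) (f-inj fk≡fi) k∈e

∈-preimage⁺ : (g : Fin n → Fin N) {h : Subset N} {i : Fin n} → g i ∈ h → i ∈ preimage g h
∈-preimage⁺ g {h} {i} gi∈h = lookup⇒[]= i (preimage g h) (trans (lookup∘tabulate _ i) ([]=⇒lookup gi∈h))

∈-preimage⁻ : (g : Fin n → Fin N) (h : Subset N) {i : Fin n} → i ∈ preimage g h → g i ∈ h
∈-preimage⁻ g h {i} i∈ = lookup⇒[]= (g i) h (trans (sym (lookup∘tabulate _ i)) ([]=⇒lookup i∈))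

∉⇒lookup≡outside : {p : Subset n} {x : Fin n} → x ∉ p → lookup p x ≡ outside
∉⇒lookup≡outside {p = p} {x} x∉p = Bool.¬-not (x∉p ∘ lookup⇒[]= x p)

image-∘ : (f : Fin n → Fin m) (g : Fin m → Fin N) (e : Subset n) → image (g ∘ f) e ≡ image g (image f e)
image-∘ f g e = ⊆-antisym forward backward
  where
  forward : image (g ∘ f) e ⊆ image g (image f e)
  forward y∈ with ∈-image⁻ (g ∘ f) e y∈
  ... | i , i∈e , refl = ∈-image⁺ g (∈-image⁺ f i∈e)
  backward : image g (image f e) ⊆ image (g ∘ f) e
  backward y∈ with ∈-image⁻ g (image f e) y∈
  ... | j , j∈ , refl with ∈-image⁻ f e j∈
  ...   | i , i∈e , refl = ∈-image⁺ (g ∘ f) i∈e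

image-id : (e : Subset n) → image id e ≡ e
image-id e = ⊆-antisym (λ y∈ → case ∈-image⁻ id e y∈ of λ { (i , i∈e , refl) → i∈e }) (∈-image⁺ id)

image-[] : (f : Fin 0 → Fin N) → image f [] ≡ ⊥
image-[] f = ⊆-antisym (λ y∈ → case ∈-image⁻ f [] y∈ of λ { (() , _) }) (⊥-elim ∘ ∉⊥)

image-outside : (f : Fin (suc n) → Fin N) (e : Subset n) → image f (outside ∷ e) ≡ image (f ∘ suc) e
image-outside f e = ⊆-antisym forward backward
  where
  forward : image f (outside ∷ e) ⊆ image (f ∘ suc) e
  forward y∈ with ∈-image⁻ f (outside ∷ e) y∈
  ... | suc i , there i∈e , refl = ∈-image⁺ (f ∘ suc) i∈e
  backward : image (f ∘ suc) e ⊆ image f (outside ∷ e)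
  backward y∈ with ∈-image⁻ (f ∘ suc) e y∈
  ... | i , i∈e , refl = ∈-image⁺ f {outside ∷ e} (there i∈e)

image-inside : (f : Fin (suc n) → Fin N) (e : Subset n) → image f (inside ∷ e) ≡ ⁅ f zero ⁆ ∪ image (f ∘ suc) e
image-inside f e = ⊆-antisym forward backward
  where
  forward : image f (inside ∷ e) ⊆ ⁅ f zero ⁆ ∪ image (f ∘ suc) e
  forward y∈ with ∈-image⁻ f (inside ∷ e) y∈
  ... | zero  , _           , refl = x∈p∪q⁺ (inj₁ (x∈⁅x⁆ (f zero)))
  ... | suc i , there i∈e , refl = x∈p∪q⁺ (inj₂ (∈-image⁺ (f ∘ suc) i∈e))
  backward : ⁅ f zero ⁆ ∪ image (f ∘ suc) e ⊆ image f (inside ∷ e)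
  backward y∈ with x∈p∪q⁻ ⁅ f zero ⁆ (image (f ∘ suc) e) y∈
  ... | inj₁ y∈⁅f0⁆ rewrite x∈⁅y⁆⇒x≡y (f zero) y∈⁅f0⁆ = ∈-image⁺ f here
  ... | inj₂ y∈′ with ∈-image⁻ (f ∘ suc) e y∈′
  ...   | i , i∈e , refl = ∈-image⁺ f {inside ∷ e} (there i∈e)

∣⁅x⁆∪p∣≡1+∣p∣ : {x : Fin n} {p : Subset n} → x ∉ p → ∣ ⁅ x ⁆ ∪ p ∣ ≡ suc ∣ p ∣
∣⁅x⁆∪p∣≡1+∣p∣ {x = zero}  {outside ∷ p} _   = cong (suc ∘ ∣_∣) (∪-identityˡ p)
∣⁅x⁆∪p∣≡1+∣p∣ {x = zero}  {inside ∷ p}  x∉p = ⊥-elim (x∉p here)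
∣⁅x⁆∪p∣≡1+∣p∣ {x = suc x} {outside ∷ p} x∉p = ∣⁅x⁆∪p∣≡1+∣p∣ (x∉p ∘ there)
∣⁅x⁆∪p∣≡1+∣p∣ {x = suc x} {inside ∷ p}  x∉p = cong suc (∣⁅x⁆∪p∣≡1+∣p∣ (x∉p ∘ there))

∣p∣≡1⇒p≡⁅x⁆ : (p : Subset n) → ∣ p ∣ ≡ 1 → ∃ λ x → p ≡ ⁅ x ⁆
∣p∣≡1⇒p≡⁅x⁆ (outside ∷ p) size with ∣p∣≡1⇒p≡⁅x⁆ p size
... | x , refl = suc x , refl
∣p∣≡1⇒p≡⁅x⁆ (inside ∷ p)  size = zero , cong (inside ∷_) (∣p∣≡0⇒p≡⊥ p (ℕ.suc-injective size))
  where
  ∣p∣≡0⇒p≡⊥ : (p : Subset n) → ∣ p ∣ ≡ 0 → p ≡ ⊥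
  ∣p∣≡0⇒p≡⊥ []            _    = refl
  ∣p∣≡0⇒p≡⊥ (outside ∷ p) size = cong (outside ∷_) (∣p∣≡0⇒p≡⊥ p size)

∣image∣≡∣e∣ : {f : Fin n → Fin N} → Injective _≡_ _≡_ f → (e : Subset n) → ∣ image f e ∣ ≡ ∣ e ∣
∣image∣≡∣e∣ {N = N} {f} _ [] = trans (cong ∣_∣ (image-[] f)) (∣⊥∣≡0 N)
∣image∣≡∣e∣ {f = f} f-inj (outside ∷ e) =
  trans (cong ∣_∣ (image-outside f e)) (∣image∣≡∣e∣ (suc-injective ∘ f-inj) e)
∣image∣≡∣e∣ {f = f} f-inj (inside ∷ e) = begin
  ∣ image f (inside ∷ e) ∣             ≡⟨ cong ∣_∣ (image-inside f e) ⟩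
  ∣ ⁅ f zero ⁆ ∪ image (f ∘ suc) e ∣   ≡⟨ ∣⁅x⁆∪p∣≡1+∣p∣ f0∉ ⟩
  suc ∣ image (f ∘ suc) e ∣            ≡⟨ cong suc (∣image∣≡∣e∣ (suc-injective ∘ f-inj) e) ⟩
  suc ∣ e ∣                            ∎
  where
  open ≡-Reasoning
  f0∉ : f zero ∉ image (f ∘ suc) e
  f0∉ f0∈ with ∈-image⁻ (f ∘ suc) e f0∈
  ... | i , _ , fi≡f0 with f-inj fi≡f0
  ...   | ()

preimage-∘-image : {F : Fin m → Fin N} → Injective _≡_ _≡_ F → (ι : Fin n → Fin m) (e : Subset m) →
  preimage (F ∘ ι) (image F e) ≡ preimage ι e
preimage-∘-image {F = F} F-inj ι e = ⊆-antisym
  (∈-preimage⁺ ι ∘ ∈-image-injective⁻ F-inj ∘ ∈-preimage⁻ (F ∘ ι) (image F e))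
  (∈-preimage⁺ (F ∘ ι) ∘ ∈-image⁺ F ∘ ∈-preimage⁻ ι e)

enumerate : (p : Subset n) → Σ (Fin ∣ p ∣ → Fin n) λ g → Injective _≡_ _≡_ g × (∀ k → g k ∈ p)
enumerate [] = (λ ()) , (λ { {()} }) , λ ()
enumerate (outside ∷ p) with enumerate p
... | g , g-inj , g∈p = suc ∘ g , g-inj ∘ suc-injective , there ∘ g∈p
enumerate (inside ∷ p) with enumerate p
... | g , g-inj , g∈p = zero Vector.∷ (suc ∘ g) , injective , member
  where
  injective : Injective _≡_ _≡_ (zero Vector.∷ (suc ∘ g))
  injective {zero}  {zero}  _  = refl
  injective {suc i} {suc j} eq = cong suc (g-inj (suc-injective eq))
  member : ∀ k → (zero Vector.∷ (suc ∘ g)) k ∈ inside ∷ p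
  member zero    = here
  member (suc k) = there (g∈p k)

injection-avoiding : {M : ℕ} (f : Fin n → Fin N) → Injective _≡_ _≡_ f → M ≤ N ∸ n →
  Σ (Fin M → Fin N) λ w → Injective _≡_ _≡_ w × ∀ k i → f i ≢ w k
injection-avoiding {n} {N} {M} f f-inj M≤ with enumerate (∁ (image f ⊤))
... | g , g-inj , g∈∁f = g ∘ (λ k → inject≤ k M≤′) , inject≤-injective M≤′ M≤′ _ _ ∘ g-inj , avoids
  where
  open ≡-Reasoning
  ∣∁image∣ : ∣ ∁ (image f ⊤) ∣ ≡ N ∸ n
  ∣∁image∣ = begin
    ∣ ∁ (image f ⊤) ∣  ≡⟨ ∣∁p∣≡n∸∣p∣ (image f ⊤) ⟩
    N ∸ ∣ image f ⊤ ∣  ≡⟨ cong (N ∸_) (∣image∣≡∣e∣ f-inj ⊤) ⟩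
    N ∸ ∣ ⊤ {n} ∣      ≡⟨ cong (N ∸_) (∣⊤∣≡n n) ⟩
    N ∸ n              ∎
  M≤′ : M ≤ ∣ ∁ (image f ⊤) ∣
  M≤′ = subst (M ≤_) (sym ∣∁image∣) M≤
  avoids : ∀ k i → f i ≢ g (inject≤ k M≤′)
  avoids k i eq = x∈∁p⇒x∉p (g∈∁f _) (subst (_∈ image f ⊤) eq (∈-image⁺ f ∈⊤))

IsCopy : ℕ → Colouring N → Bool → (H : Hypergraph) → (Fin (vsize H) → Fin N) → Set
IsCopy r c b H f = Injective _≡_ _≡_ f × (∀ e → Edge H e → (∣ image f e ∣ ≡ r) × (c (image f e) ≡ b))

IsCopy-restrict : {r : ℕ} {b : Bool} {H : Hypergraph} {f : Fin (vsize H) → Fin m}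
  (c : Colouring N) (w : Fin m → Fin N) → Injective _≡_ _≡_ w →
  IsCopy r (c ∘ image w) b H f → IsCopy r c b H (w ∘ f)
IsCopy-restrict {r = r} {b} {H} {f} c w w-inj (f-inj , edges) = f-inj ∘ w-inj , edges′
  where
  edges′ : ∀ e → Edge H e → (∣ image (w ∘ f) e ∣ ≡ r) × (c (image (w ∘ f) e) ≡ b)
  edges′ e e-edge rewrite image-∘ f w e with edges e e-edge
  ... | size , colour = trans (∣image∣≡∣e∣ w-inj (image f e)) size , colour

ContainsFam-restrict : {r : ℕ} {b : Bool} {F : Family} (c : Colouring N) (w : Fin m → Fin N) →
  Injective _≡_ _≡_ w → ContainsFam r (c ∘ image w) b F → ContainsFam r c b F
ContainsFam-restrict c w w-inj (H , H∈F , f , f-copy) = H , H∈F , w ∘ f , IsCopy-restrict c w w-inj f-copy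

RamseyProperty-embed : {r : ℕ} {F₁ F₂ : Family} → RamseyProperty r F₁ F₂ m →
  (w : Fin m → Fin N) → Injective _≡_ _≡_ w →
  (c : Colouring N) → ContainsFam r c true F₁ ⊎ ContainsFam r c false F₂
RamseyProperty-embed ramsey w w-inj c =
  Sum.map (ContainsFam-restrict c w w-inj) (ContainsFam-restrict c w w-inj) (ramsey (c ∘ image w))

IsCopy-id : {r : ℕ} {b : Bool} (H : Hypergraph) (c : Colouring (vsize H)) →
  Uniform r H → (∀ h → Edge H h → c h ≡ b) → IsCopy r c b H id
IsCopy-id H c uniform colour = id , λ h h-edge →
  subst (λ h′ → (∣ h′ ∣ ≡ _) × (c h′ ≡ _)) (sym (image-id h)) (uniform h h-edge , colour h h-edge)

-- The apex of S K_t is vertex zero; x is inserted as the first base vertex.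
extendBase : {t : ℕ} → (Fin (suc t) → Fin N) → Fin N → Fin (suc (suc t)) → Fin N
extendBase f x zero          = f zero
extendBase f x (suc zero)    = x
extendBase f x (suc (suc k)) = f (suc k)

extendBase-injective : {t : ℕ} {f : Fin (suc t) → Fin N} {x : Fin N} →
  Injective _≡_ _≡_ f → (∀ i → f i ≢ x) → Injective _≡_ _≡_ (extendBase f x)
extendBase-injective f-inj x∉f {zero}        {zero}        _  = refl
extendBase-injective f-inj x∉f {zero}        {suc zero}    eq = ⊥-elim (x∉f zero eq)
extendBase-injective f-inj x∉f {zero}        {suc (suc j)} eq with f-inj eq
... | ()
extendBase-injective f-inj x∉f {suc zero}    {zero}        eq = ⊥-elim (x∉f zero (sym eq))
extendBase-injective f-inj x∉f {suc zero}    {suc zero}    _  = refl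
extendBase-injective f-inj x∉f {suc zero}    {suc (suc j)} eq = ⊥-elim (x∉f (suc j) (sym eq))
extendBase-injective f-inj x∉f {suc (suc i)} {zero}        eq with f-inj eq
... | ()
extendBase-injective f-inj x∉f {suc (suc i)} {suc zero}    eq = ⊥-elim (x∉f (suc i) eq)
extendBase-injective f-inj x∉f {suc (suc i)} {suc (suc j)} eq = cong suc (f-inj eq)

∈-image-extendBase : {t : ℕ} {f : Fin (suc t) → Fin N} {x y : Fin N} (e : Subset (suc (suc t))) →
  (∀ i → f i ≢ y) → y ∈ image (extendBase f x) e → y ≡ x
∈-image-extendBase {f = f} {x} e y∉f y∈ with ∈-image⁻ (extendBase f x) e y∈
... | zero        , _ , refl = ⊥-elim (y∉f zero refl)
... | suc zero    , _ , refl = refl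
... | suc (suc k) , _ , refl = ⊥-elim (y∉f (suc k) refl)

IsCopy-extendBase : {a t : ℕ} {b : Bool} {c : Colouring N} {f : Fin (suc t) → Fin N} {x : Fin N} →
  IsCopy (suc (suc a)) c b (SK (suc a) t) f → (∀ i → f i ≢ x) →
  (∀ e → ∣ e ∣ ≡ a → c (image (extendBase f x) (inside ∷ inside ∷ e)) ≡ b) →
  IsCopy (suc (suc a)) c b (SK (suc a) (suc t)) (extendBase f x)
IsCopy-extendBase {a = a} {b = b} {c} {f} {x} (f-inj , edges) x∉f through-x =
  extendBase-injective f-inj x∉f , λ where
    _ (e , size , refl) → trans (∣image∣≡∣e∣ (extendBase-injective f-inj x∉f) (inside ∷ e)) (cong suc size) ,
                          colour e size
  where
  colour : ∀ e → ∣ e ∣ ≡ suc a → c (image (extendBase f x) (inside ∷ e)) ≡ b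
  colour (inside ∷ e)  size = through-x e (ℕ.suc-injective size)
  colour (outside ∷ e) size = begin
    c (image (extendBase f x) (inside ∷ outside ∷ e))   ≡⟨ cong c avoid-x ⟩
    c (image f (inside ∷ e))                            ≡⟨ proj₂ (edges _ (e , size , refl)) ⟩
    b                                                   ∎
    where
    open ≡-Reasoning
    avoid-x : image (extendBase f x) (inside ∷ outside ∷ e) ≡ image f (inside ∷ e)
    avoid-x = begin
      image (extendBase f x) (inside ∷ outside ∷ e)          ≡⟨ image-inside (extendBase f x) (outside ∷ e) ⟩
      ⁅ f zero ⁆ ∪ image (extendBase f x ∘ suc) (outside ∷ e) ≡⟨ cong (⁅ f zero ⁆ ∪_) (image-outside (extendBase f x ∘ suc) e) ⟩
      ⁅ f zero ⁆ ∪ image (f ∘ suc) e                         ≡⟨ image-inside f e ⟨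
      image f (inside ∷ e)                                   ∎

TraceEmbedding : ℕ → (s : ℕ) (H : Hypergraph) → (Fin s → Fin (vsize H)) → Set
TraceEmbedding a s H ι =
  Injective _≡_ _≡_ ι × Uniform (suc a) H ×
  (∀ h → Edge H h → ∣ preimage ι h ∣ ≡ 2) ×
  (∀ (p : Subset s) → ∣ p ∣ ≡ 2 → Σ (Subset (vsize H)) λ h → Edge H h × (preimage ι h ≡ p))

pushforward : (H : Hypergraph) → (Fin (vsize H) → Fin N) → Hypergraph
pushforward {N} H G = record
  { vsize = N ; Edge = λ h → Σ (Subset (vsize H)) λ e → Edge H e × (h ≡ image G e) }

TraceEmbedding-pushforward : {a s : ℕ} {H : Hypergraph} {ι : Fin s → Fin (vsize H)} {G : Fin (vsize H) → Fin N} →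
  Injective _≡_ _≡_ G → TraceEmbedding a s H ι → TraceEmbedding a s (pushforward H G) (G ∘ ι)
TraceEmbedding-pushforward {ι = ι} {G} G-inj (ι-inj , uniform , traces , covers) =
  ι-inj ∘ G-inj ,
  (λ { _ (e , e-edge , refl) → trans (∣image∣≡∣e∣ G-inj e) (uniform e e-edge) }) ,
  (λ { _ (e , e-edge , refl) → trans (cong ∣_∣ (preimage-∘-image G-inj ι e)) (traces e e-edge) }) ,
  λ p size → case covers p size of λ where
    (e , e-edge , trace) → image G e , (e , e-edge , refl) , trans (preimage-∘-image G-inj ι e) trace

addEdges : {k : ℕ} (H : Hypergraph) → (Fin k → Subset (vsize H)) → Hypergraph
addEdges H B = record { vsize = vsize H ; Edge = λ h → Edge H h ⊎ ∃ λ i → h ≡ B i }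

TraceEmbedding-addApex : {a s : ℕ} {H : Hypergraph} {ι : Fin s → Fin (vsize H)}
  (v : Fin (vsize H)) (B : Fin s → Subset (vsize H)) → TraceEmbedding a s H ι →
  (∀ i → ι i ≢ v) → (∀ h → Edge H h → v ∉ h) →
  (∀ i → ∣ B i ∣ ≡ suc a) → (∀ i → v ∈ B i) → (∀ i → preimage ι (B i) ≡ ⁅ i ⁆) →
  TraceEmbedding a (suc s) (addEdges H B) (v Vector.∷ ι)
TraceEmbedding-addApex {a} {s} {H} {ι} v B (ι-inj , uniform , traces , covers) ι≢v v∉H B-size v∈B B-trace =
  injective , uniform′ , traces′ , covers′
  where
  injective : Injective _≡_ _≡_ (v Vector.∷ ι)
  injective {zero}  {zero}  _  = refl
  injective {zero}  {suc j} eq = ⊥-elim (ι≢v j (sym eq))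
  injective {suc i} {zero}  eq = ⊥-elim (ι≢v i eq)
  injective {suc i} {suc j} eq = cong suc (ι-inj eq)
  old-trace : ∀ h → Edge H h → preimage (v Vector.∷ ι) h ≡ outside ∷ preimage ι h
  old-trace h h-edge = cong (_∷ preimage ι h) (∉⇒lookup≡outside (v∉H h h-edge))
  new-trace : ∀ i → preimage (v Vector.∷ ι) (B i) ≡ inside ∷ ⁅ i ⁆
  new-trace i = cong₂ _∷_ ([]=⇒lookup (v∈B i)) (B-trace i)
  uniform′ : Uniform (suc a) (addEdges H B)
  uniform′ h (inj₁ h-edge)     = uniform h h-edge
  uniform′ _ (inj₂ (i , refl)) = B-size i
  traces′ : ∀ h → Edge (addEdges H B) h → ∣ preimage (v Vector.∷ ι) h ∣ ≡ 2
  traces′ h (inj₁ h-edge)     = trans (cong ∣_∣ (old-trace h h-edge)) (traces h h-edge)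
  traces′ _ (inj₂ (i , refl)) = trans (cong ∣_∣ (new-trace i)) (cong suc (∣⁅x⁆∣≡1 i))
  covers′ : ∀ (p : Subset (suc s)) → ∣ p ∣ ≡ 2 →
    Σ (Subset (vsize H)) λ h → Edge (addEdges H B) h × (preimage (v Vector.∷ ι) h ≡ p)
  covers′ (outside ∷ p) size with covers p size
  ... | h , h-edge , refl = h , inj₁ h-edge , old-trace h h-edge
  covers′ (inside ∷ p)  size with ∣p∣≡1⇒p≡⁅x⁆ p (ℕ.suc-injective size)
  ... | i , refl = B i , inj₂ (i , refl) , new-trace i

module _ {a t s R₂ N : ℕ} (c : Colouring N)
  (ramsey₂ : RamseyProperty (suc (suc a)) (single (SK (suc a) (suc t))) (TK (suc a) s) R₂)
  {f : Fin (suc t) → Fin N} (f-copy : IsCopy (suc (suc a)) c true (SK (suc a) t) f)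
  (w : Fin R₂ → Fin N) (w-inj : Injective _≡_ _≡_ w) (w∉f : ∀ k i → f i ≢ w k) where

  -- u = f zero, x, and a base vertices of the copy f.
  BlueFan : Fin N → Set
  BlueFan x = Σ (Subset t) λ e → ∣ e ∣ ≡ a × c (image (extendBase f x) (inside ∷ inside ∷ e)) ≡ false

  blueFan? : ∀ x → Dec (BlueFan x)
  blueFan? x = anySubset? λ e →
    (∣ e ∣ ℕ.≟ a) ×-dec (c (image (extendBase f x) (inside ∷ inside ∷ e)) Bool.≟ false)

  red-suspension : ∀ k → ¬ BlueFan (w k) → ContainsCopy (suc (suc a)) c true (SK (suc a) (suc t))
  red-suspension k no-fan = extendBase f (w k) ,
    IsCopy-extendBase {c = c} f-copy (w∉f k) λ e size → Bool.¬-not λ blue → no-fan (e , size , blue)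

  blue-trace : (∀ k → BlueFan (w k)) →
    ContainsFam (suc (suc a)) (c ∘ image w) false (TK (suc a) s) →
    ContainsFam (suc (suc a)) c false (TK (suc a) (suc s))
  blue-trace fans (H , lift (ι , ι-emb) , g , g-copy) =
    addEdges (pushforward H G) B , lift (f zero Vector.∷ (G ∘ ι) , emb) , id , IsCopy-id _ c (proj₁ (proj₂ emb)) colour
    where
    G : Fin (vsize H) → Fin N
    G = w ∘ g
    G-copy : IsCopy (suc (suc a)) c false H G
    G-copy = IsCopy-restrict c w w-inj g-copy
    Gι-inj : Injective _≡_ _≡_ (G ∘ ι)
    Gι-inj = proj₁ ι-emb ∘ proj₁ G-copy
    fan : ∀ i → BlueFan (G (ι i))
    fan i = fans (g (ι i))
    B : Fin s → Subset N
    B i = image (extendBase f (G (ι i))) (inside ∷ inside ∷ proj₁ (fan i))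
    -- Besides G (ι i), the vertices of B i lie in the copy f, which G avoids.
    B-trace : ∀ i → preimage (G ∘ ι) (B i) ≡ ⁅ i ⁆
    B-trace i = ⊆-antisym forward backward
      where
      forward : preimage (G ∘ ι) (B i) ⊆ ⁅ i ⁆
      forward {k} k∈ = subst (_∈ ⁅ i ⁆) (sym (Gι-inj Gιk≡Gιi)) (x∈⁅x⁆ i)
        where
        Gιk≡Gιi : G (ι k) ≡ G (ι i)
        Gιk≡Gιi = ∈-image-extendBase {f = f} (inside ∷ inside ∷ proj₁ (fan i)) (w∉f (g (ι k)))
                    (∈-preimage⁻ (G ∘ ι) (B i) k∈)
      backward : ⁅ i ⁆ ⊆ preimage (G ∘ ι) (B i)
      backward k∈ rewrite x∈⁅y⁆⇒x≡y i k∈ =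
        ∈-preimage⁺ (G ∘ ι) (∈-image⁺ (extendBase f (G (ι i))) {inside ∷ inside ∷ _} (there here))
    core∌apex : ∀ i → G (ι i) ≢ f zero
    core∌apex i = w∉f (g (ι i)) zero ∘ sym
    H∌apex : ∀ h → Edge (pushforward H G) h → f zero ∉ h
    H∌apex _ (e , _ , refl) apex∈ with ∈-image⁻ G e apex∈
    ... | k , _ , Gk≡apex = w∉f (g k) zero (sym Gk≡apex)
    ∣B∣ : ∀ i → ∣ B i ∣ ≡ suc (suc a)
    ∣B∣ i = trans (∣image∣≡∣e∣ (extendBase-injective {f = f} (proj₁ f-copy) (w∉f (g (ι i)))) (inside ∷ inside ∷ proj₁ (fan i)))
                  (cong (λ k → suc (suc k)) (proj₁ (proj₂ (fan i))))
    B∋apex : ∀ i → f zero ∈ B i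
    B∋apex i = ∈-image⁺ (extendBase f (G (ι i))) here
    emb : TraceEmbedding (suc a) (suc s) (addEdges (pushforward H G) B) (f zero Vector.∷ (G ∘ ι))
    emb = TraceEmbedding-addApex (f zero) B (TraceEmbedding-pushforward (proj₁ G-copy) ι-emb)
      core∌apex H∌apex ∣B∣ B∋apex B-trace
    colour : ∀ h → Edge (addEdges (pushforward H G) B) h → c h ≡ false
    colour _ (inj₁ (e , e-edge , refl)) = proj₂ (proj₂ G-copy e e-edge)
    colour _ (inj₂ (i , refl))          = proj₂ (proj₂ (fan i))

  extend-suspension : ContainsFam (suc (suc a)) c true (single (SK (suc a) (suc t))) ⊎
                      ContainsFam (suc (suc a)) c false (TK (suc a) (suc s))
  extend-suspension with all? (blueFan? ∘ w)
  ... | yes fans = Sum.map (ContainsFam-restrict c w w-inj) (blue-trace fans) (ramsey₂ (c ∘ image w))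
  ... | no ¬fans with ¬∀⟶∃¬ R₂ (BlueFan ∘ w) (blueFan? ∘ w) ¬fans
  ...   | k , no-fan = inj₁ (_ , refl , red-suspension k no-fan)

RamseyProperty-step : {a t s R₁ R₂ : ℕ} →
  RamseyProperty (suc (suc a)) (single (SK (suc a) t)) (TK (suc a) (suc s)) R₁ →
  RamseyProperty (suc (suc a)) (single (SK (suc a) (suc t))) (TK (suc a) s) R₂ →
  RamseyProperty (suc (suc a)) (single (SK (suc a) (suc t))) (TK (suc a) (suc s)) (suc t + (R₁ ⊔ R₂))
RamseyProperty-step {t = t} {R₁ = R₁} {R₂} ramsey₁ ramsey₂ c
  with RamseyProperty-embed ramsey₁ (λ k → inject≤ k R₁≤) (inject≤-injective R₁≤ R₁≤ _ _) c
  where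
  R₁≤ : R₁ ≤ suc t + (R₁ ⊔ R₂)
  R₁≤ = ℕ.≤-trans (ℕ.m≤m⊔n R₁ R₂) (ℕ.m≤n+m _ (suc t))
... | inj₂ blue = inj₂ blue
... | inj₁ (_ , refl , f , f-copy) with injection-avoiding f (proj₁ f-copy) R₂≤
  where
  R₂≤ : R₂ ≤ suc t + (R₁ ⊔ R₂) ∸ suc t
  R₂≤ = subst (R₂ ≤_) (sym (ℕ.m+n∸m≡n (suc t) (R₁ ⊔ R₂))) (ℕ.m≤n⊔m R₁ R₂)
...   | w , w-inj , w∉f = extend-suspension c ramsey₂ f-copy w w-inj w∉f

proposition4p3 : (a t s : ℕ) → a + 1 ≤ t → 3 ≤ a + 1 → 2 ≤ s →
    (R₀ R₁ R₂ : ℕ) →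
    IsRamseyNumber (a + 1) (single (SK a t)) (TK a s) R₀ →
    IsRamseyNumber (a + 1) (single (SK a (t ∸ 1))) (TK a s) R₁ →
    IsRamseyNumber (a + 1) (single (SK a t)) (TK a (s ∸ 1)) R₂ →
    R₀ ≤ t + (R₁ ⊔ R₂)
proposition4p3 zero    _       _       _ (s≤s ()) _  _ _ _ _ _ _
proposition4p3 (suc a) zero    _       () _ _ _ _ _ _ _ _
proposition4p3 (suc a) (suc t) zero    _ _ () _ _ _ _ _ _
proposition4p3 (suc a) (suc t) (suc s) _ _ _ R₀ R₁ R₂ (_ , minimal) (ramsey₁ , _) (ramsey₂ , _) =
  minimal _ (at-rank r≡ (RamseyProperty-step (at-rank (sym r≡) ramsey₁) (at-rank (sym r≡) ramsey₂)))
  where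
  r≡ : suc (suc a) ≡ suc a + 1
  r≡ = cong suc (ℕ.+-comm 1 a)
  at-rank : ∀ {r r′ F₁ F₂ M} → r ≡ r′ → RamseyProperty r F₁ F₂ M → RamseyProperty r′ F₁ F₂ M
  at-rank refl ramsey = ramsey
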